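{- Let $\mathbb{F}$ be a field with $|\mathbb{F}|=2$ and let $n\ge 2$ be an integer. Then the unitary Cayley graph $C_{T_n(\mathbb{F})}$ has exactly $2^{n-1}$ connected components, and each connected component is isomorphic to the complete bipartite graph $K_{m,m}$, where $m=2^{\frac{n(n-1)}{2}}$.
   Context: For a finite ring $R$ with identity, the unitary Cayley graph $C_R$ is the simple graph with vertex set $R$ in which distinct $x,y\in R$ are adjacent if and only if $x-y$ is a unit of $R$. $T_n(\mathbb{F})$ denotes the ring of all upper triangular $n\times n$ matrices over $\mathbb{F}$. -}

module Defs where

open import Data.Bool using (Bool; true; false; _xor_; _∧_; _∨_; not; T)
open import Data.Nat using (ℕ; zero; suc; _<ᵇ_; _≡ᵇ_)
open import Data.Fin using (Fin; toℕ) renaming (zero to fzero; suc to fsuc)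
open import Data.Vec using (Vec; lookup; tabulate)
open import Data.List using (List; []; _∷_; allFin)
open import Data.Product using (Σ; ∃; _×_; _,_; proj₁)
open import Data.Sum using (_⊎_; inj₁; inj₂)
open import Data.Unit using (⊤)
open import Data.Empty using (⊥)
open import Relation.Nullary using (¬_)
open import Relation.Binary.PropositionalEquality using (_≡_)
open import Relation.Binary.Construct.Closure.ReflexiveTransitive using (Star)
open import Function using (_⇔_)

-- The field with two elements: carrier Bool, + = xor, · = ∧.
-- (Every field with |F| = 2 is isomorphic to this one.)

𝔽 : Set
𝔽 = Bool

0𝔽 1𝔽 : 𝔽
0𝔽 = false
1𝔽 = true

_+𝔽_ _*𝔽_ _-𝔽_ : 𝔽 → 𝔽 → 𝔽
x +𝔽 y = x xor y
x *𝔽 y = x ∧ y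
-- additive inverse in 𝔽₂ is the identity, so x - y = x + (-y) = x xor y
x -𝔽 y = x xor y

Σ𝔽 : ∀ {n} → (Fin n → 𝔽) → 𝔽
Σ𝔽 {zero}  f = 0𝔽
Σ𝔽 {suc n} f = f fzero +𝔽 Σ𝔽 (λ i → f (fsuc i))

Mat : ℕ → Set
Mat n = Vec (Vec 𝔽 n) n

entry : ∀ {n} → Mat n → Fin n → Fin n → 𝔽
entry A i j = lookup (lookup A i) j

_·_ : ∀ {n} → Mat n → Mat n → Mat n
A · B = tabulate λ i → tabulate λ j → Σ𝔽 λ k → entry A i k *𝔽 entry B k j

_−_ : ∀ {n} → Mat n → Mat n → Mat n
A − B = tabulate λ i → tabulate λ j → entry A i j -𝔽 entry B i j

I : ∀ {n} → Mat n
I = tabulate λ i → tabulate λ j → if' (toℕ i ≡ᵇ toℕ j)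
  where
    if' : Bool → 𝔽
    if' true  = 1𝔽
    if' false = 0𝔽

allB : {A : Set} → (A → Bool) → List A → Bool
allB p []       = true
allB p (x ∷ xs) = p x ∧ allB p xs

isUpper : ∀ {n} → Mat n → Bool
isUpper {n} A =
  allB (λ i → allB (λ j → not (toℕ j <ᵇ toℕ i) ∨ not (entry A i j)) (allFin n)) (allFin n)

Tri : ℕ → Set
Tri n = Σ (Mat n) (λ A → T (isUpper A))

IsUnit : ∀ {n} → Mat n → Set
IsUnit {n} A = ∃ λ (B : Tri n) → (A · proj₁ B ≡ I) × (proj₁ B · A ≡ I)

CayleyAdj : ∀ {n} → Tri n → Tri n → Set
CayleyAdj x y = ¬ (x ≡ y) × IsUnit (proj₁ x − proj₁ y)

Connected : {V : Set} → (V → V → Set) → V → V → Set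
Connected Adj = Star Adj

HasExactlyComponents : {V : Set} → (V → V → Set) → ℕ → Set
HasExactlyComponents {V} Adj k =
  Σ (Fin k → V) λ rep →
    (∀ i j → Connected Adj (rep i) (rep j) → i ≡ j) ×
    (∀ v → ∃ λ i → Connected Adj (rep i) v)

KAdj : ∀ {m} → Fin m ⊎ Fin m → Fin m ⊎ Fin m → Set
KAdj (inj₁ _) (inj₁ _) = ⊥
KAdj (inj₁ _) (inj₂ _) = ⊤
KAdj (inj₂ _) (inj₁ _) = ⊤
KAdj (inj₂ _) (inj₂ _) = ⊥

ComponentIso : {V : Set} → (V → V → Set) → V → {W : Set} → (W → W → Set) → Set
ComponentIso {V} Adj v {W} AdjW =
  Σ (W → V) λ φ →
    (∀ w → Connected Adj v (φ w)) ×
    (∀ a b → φ a ≡ φ b → a ≡ b) ×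
    (∀ u → Connected Adj v u → ∃ λ w → φ w ≡ u) ×
    (∀ a b → Adj (φ a) (φ b) ⇔ AdjW a b)

{-# OPTIONS --safe #-}
module Submission where

-- Over 𝔽₂ an upper triangular matrix is a unit of T n exactly when its diagonal
-- is all ones (the inverse is then built by block recursion), so x and y are
-- adjacent iff diag x + diag y = (1, …, 1). Along a path diag x + diag y is
-- therefore constant, and conversely two vertices with constant diag x + diag y
-- are joined by a path of length at most two. Hence the components are the
-- classes {d , d + 1} of diagonals, 2ⁿ / 2 = 2ⁿ⁻¹ of them, and the component of
-- v is complete bipartite between the matrices with diagonal diag v and those
-- with diagonal diag v + 1, each side parametrised by the n(n-1)/2 free entries
-- above the diagonal.

open import Defs
open import Data.Nat using (ℕ; _≤_; _∸_; _^_; _*_)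
open import Data.Nat.DivMod using (_/_)
open import Data.Product using (_×_)

open import Algebra.Bundles using (CommutativeRing)
open import Data.Bool using (Bool; true; false; not; _∧_; _∨_; _xor_; T)
open import Data.Bool.ListAction using (all)
open import Data.Bool.Properties
  using ( xor-∧-commutativeRing; xor-same; xor-comm; xor-identityʳ; xor-inverseʳ
        ; not-distribˡ-xor; not-involutive; ∧-assoc; ∧-identityʳ; ∧-zeroʳ; ∧-conicalˡ
        ; T-irrelevant)
open import Data.Empty using (⊥-elim)
open import Data.Fin using (Fin; zero; suc; toℕ; _<_; punchIn)
open import Data.Fin.Properties using (<-cmp; punchInᵢ≢i; 1↔⊤; 2↔Bool; *↔×)
open import Data.List using (List; []; _∷_; allFin)
open import Data.List.Membership.Propositional using (_∈_)
open import Data.List.Membership.Propositional.Properties using (∈-allFin)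
import Data.List.Relation.Unary.All as All
open import Data.List.Relation.Unary.All.Properties using (all⁺; all⁻)
open import Data.Nat using (zero; suc; _+_; _<ᵇ_; s≤s; z<s)
open import Data.Nat.DivMod using (m*n/n≡m)
open import Data.Nat.Properties
  using (*-comm; *-distribʳ-+; *-distribˡ-+; <⇒<ᵇ; <ᵇ⇒<; ^-distribˡ-+-*)
open import Data.Product using (Σ; ∃; ∃-syntax; _,_; proj₁; uncurry)
open import Data.Product.Function.NonDependent.Propositional using (_×-↔_)
open import Data.Product.Properties using (Σ-≡,≡→≡)
open import Data.Sum using (_⊎_; inj₁; inj₂; [_,_]′; reduce)
open import Data.Unit using (⊤; tt)
open import Data.Vec using (Vec; []; _∷_; lookup; tabulate)
open import Data.Vec.Functional using (removeAt)
open import Data.Vec.Properties using (lookup∘tabulate; tabulate∘lookup; tabulate-cong)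
open import Function
  using (_∘_; const; _⇔_; mk⇔; _↔_; mk↔ₛ′; Equivalence; Inverse; Injection)
import Function.Properties.Equivalence as ⇔
open import Function.Properties.Inverse using (↔-trans; ↔⇒↣)
open import Relation.Binary.Construct.Closure.ReflexiveTransitive using (ε; _◅_)
open import Relation.Binary.Definitions using (tri<; tri≈; tri>)
open import Relation.Binary.PropositionalEquality
  using (_≡_; _≢_; _≗_; refl; sym; trans; cong; cong₂; subst; module ≡-Reasoning)
open import Relation.Nullary using (contradiction)

open CommutativeRing xor-∧-commutativeRing using (semiring; +-group; +-abelianGroup)
open import Algebra.Properties.Semiring.Sum semiring
  using (sum; sum-cong-≗; sum-replicate-zero; sum-remove; ∑-comm; *-distribˡ-sum; *-distribʳ-sum)
open import Algebra.Properties.Group +-group using (∙-cancelˡ; ∙-cancelʳ; \\-leftDividesˡ)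
open import Algebra.Properties.AbelianGroup +-abelianGroup using (xyx⁻¹≈y)

open ≡-Reasoning

private
  variable
    n : ℕ

Σ𝔽≡sum : (f : Fin n → 𝔽) → Σ𝔽 f ≡ sum f
Σ𝔽≡sum {zero}  f = refl
Σ𝔽≡sum {suc n} f = cong (f zero xor_) (Σ𝔽≡sum (f ∘ suc))

sum-zero : {f : Fin n → 𝔽} → (∀ k → f k ≡ false) → sum f ≡ false
sum-zero {n} f≡0 = trans (sum-cong-≗ f≡0) (sum-replicate-zero n)

sum-single : (f : Fin n → 𝔽) (i : Fin n) → (∀ k → k ≢ i → f k ≡ false) → sum f ≡ f i
sum-single {suc n} f i vanish = begin
  sum f                       ≡⟨ sum-remove {i = i} f ⟩
  f i xor sum (removeAt f i)  ≡⟨ cong (f i xor_) (sum-zero λ k → vanish _ (punchInᵢ≢i i k)) ⟩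
  f i xor false               ≡⟨ xor-identityʳ (f i) ⟩
  f i                         ∎

-- Matrices as entry functions

Matrix : ℕ → Set
Matrix n = Fin n → Fin n → 𝔽

toMat : Matrix n → Mat n
toMat A = tabulate λ i → tabulate (A i)

entry-toMat : (A : Matrix n) (i j : Fin n) → entry (toMat A) i j ≡ A i j
entry-toMat A i j = begin
  lookup (lookup (toMat A) i) j  ≡⟨ cong (λ r → lookup r j) (lookup∘tabulate _ i) ⟩
  lookup (tabulate (A i)) j      ≡⟨ lookup∘tabulate (A i) j ⟩
  A i j                          ∎

Vec-ext : {A : Set} {u v : Vec A n} → lookup u ≗ lookup v → u ≡ v
Vec-ext {u = u} {v} u≗v = begin
  u                    ≡⟨ tabulate∘lookup u ⟨
  tabulate (lookup u)  ≡⟨ tabulate-cong u≗v ⟩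
  tabulate (lookup v)  ≡⟨ tabulate∘lookup v ⟩
  v                    ∎

Mat-ext : {A B : Mat n} → (∀ i j → entry A i j ≡ entry B i j) → A ≡ B
Mat-ext A≗B = Vec-ext λ i → Vec-ext (A≗B i)

_⊛_ : (Fin n → 𝔽) → Matrix n → Fin n → 𝔽
(r ⊛ B) j = sum λ k → r k ∧ B k j

_⊙_ : Matrix n → Matrix n → Matrix n
(A ⊙ B) i = A i ⊛ B

⊛-cong : (r : Fin n → 𝔽) {B C : Matrix n} → (∀ i j → B i j ≡ C i j) →
         ∀ j → (r ⊛ B) j ≡ (r ⊛ C) j
⊛-cong r B≗C j = sum-cong-≗ λ k → cong (r k ∧_) (B≗C k j)

⊛-⊙-assoc : (r : Fin n → 𝔽) (B C : Matrix n) (j : Fin n) →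
            ((r ⊛ B) ⊛ C) j ≡ (r ⊛ (B ⊙ C)) j
⊛-⊙-assoc r B C j = begin
  sum (λ k → sum (λ l → r l ∧ B l k) ∧ C k j)
    ≡⟨ sum-cong-≗ (λ k → *-distribʳ-sum (C k j) (λ l → r l ∧ B l k)) ⟩
  sum (λ k → sum (λ l → (r l ∧ B l k) ∧ C k j))
    ≡⟨ ∑-comm (λ k l → (r l ∧ B l k) ∧ C k j) ⟩
  sum (λ l → sum (λ k → (r l ∧ B l k) ∧ C k j))
    ≡⟨ sum-cong-≗ (λ l → sum-cong-≗ λ k → ∧-assoc (r l) (B l k) (C k j)) ⟩
  sum (λ l → sum (λ k → r l ∧ (B l k ∧ C k j)))
    ≡⟨ sum-cong-≗ (λ l → *-distribˡ-sum (r l) (λ k → B l k ∧ C k j)) ⟨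
  sum (λ l → r l ∧ (B ⊙ C) l j)
    ∎

entry-· : (A B : Mat n) (i j : Fin n) → entry (A · B) i j ≡ (entry A ⊙ entry B) i j
entry-· A B i j = trans (entry-toMat _ i j) (Σ𝔽≡sum λ k → entry A i k ∧ entry B k j)

δ : Matrix n
δ zero    zero    = true
δ zero    (suc j) = false
δ (suc i) zero    = false
δ (suc i) (suc j) = δ i j

δ-refl : (i : Fin n) → δ i i ≡ true
δ-refl zero    = refl
δ-refl (suc i) = δ-refl i

δ-≢ : {i j : Fin n} → i ≢ j → δ i j ≡ false
δ-≢ {i = zero}  {zero}  i≢j = ⊥-elim (i≢j refl)
δ-≢ {i = zero}  {suc j} i≢j = refl
δ-≢ {i = suc i} {zero}  i≢j = refl
δ-≢ {i = suc i} {suc j} i≢j = δ-≢ (i≢j ∘ cong suc)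

⊛-δ : (r : Fin n → 𝔽) (j : Fin n) → (r ⊛ δ) j ≡ r j
⊛-δ r j = begin
  sum (λ k → r k ∧ δ k j)  ≡⟨ sum-single _ j (λ k k≢j → trans (cong (r k ∧_) (δ-≢ k≢j)) (∧-zeroʳ (r k))) ⟩
  r j ∧ δ j j              ≡⟨ cong (r j ∧_) (δ-refl j) ⟩
  r j ∧ true               ≡⟨ ∧-identityʳ (r j) ⟩
  r j                      ∎

-- Defs tabulates I through a where-bound helper, which cannot be named here;
-- unification recovers the entry function of I instead.
I-table : ∀ n → Σ (Matrix n) λ A → I ≡ toMat A
I-table n = _ , refl

I-table≡δ : (i j : Fin n) → proj₁ (I-table n) i j ≡ δ i j
I-table≡δ zero    zero    = refl
I-table≡δ zero    (suc j) = refl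
I-table≡δ (suc i) zero    = refl
I-table≡δ (suc i) (suc j) = I-table≡δ i j

entry-I : (i j : Fin n) → entry (I {n}) i j ≡ δ i j
entry-I {n} i j = trans (entry-toMat (proj₁ (I-table n)) i j) (I-table≡δ i j)

Upper : Matrix n → Set
Upper A = ∀ i j → j < i → A i j ≡ false

allB≡all : {A : Set} (p : A → Bool) (xs : List A) → allB p xs ≡ all p xs
allB≡all p []       = refl
allB≡all p (x ∷ xs) = cong (p x ∧_) (allB≡all p xs)

allB-lookup : {A : Set} {p : A → Bool} {xs : List A} {x : A} → T (allB p xs) → x ∈ xs → T (p x)
allB-lookup {p = p} {xs} t = All.lookup (all⁺ p xs (subst T (allB≡all p xs) t))

allB-universal : {A : Set} {p : A → Bool} (xs : List A) → (∀ x → T (p x)) → T (allB p xs)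
allB-universal {p = p} xs h = subst T (sym (allB≡all p xs)) (all⁻ p (All.universal h xs))

T-¬∨¬ : ∀ a b → T (not a ∨ not b) ⇔ (T a → b ≡ false)
T-¬∨¬ false b     = mk⇔ (λ _ ()) (λ _ → tt)
T-¬∨¬ true  false = mk⇔ (λ _ _ → refl) (λ _ → tt)
T-¬∨¬ true  true  = mk⇔ (λ ()) (λ b≡false → contradiction (b≡false tt) λ ())

isUpper⇔Upper : (A : Mat n) → T (isUpper A) ⇔ Upper (entry A)
isUpper⇔Upper {n} A = mk⇔ to from
  where
    cell : ∀ i j → T (not (toℕ j <ᵇ toℕ i) ∨ not (entry A i j)) ⇔ (j < i → entry A i j ≡ false)
    cell i j = mk⇔ (λ t j<i → Equivalence.to (T-¬∨¬ _ _) t (<⇒<ᵇ j<i))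
                   (λ h → Equivalence.from (T-¬∨¬ _ _) (h ∘ <ᵇ⇒< (toℕ j) (toℕ i)))

    to : T (isUpper A) → Upper (entry A)
    to t i j = Equivalence.to (cell i j) (allB-lookup (allB-lookup t (∈-allFin i)) (∈-allFin j))

    from : Upper (entry A) → T (isUpper A)
    from up = allB-universal (allFin n) λ i →
              allB-universal (allFin n) λ j → Equivalence.from (cell i j) (up i j)

entries : Tri n → Matrix n
entries x = entry (proj₁ x)

diag : Tri n → Fin n → 𝔽
diag x i = entries x i i

entries-upper : (x : Tri n) → Upper (entries x)
entries-upper (A , t) = Equivalence.to (isUpper⇔Upper A) t

mkTri : (A : Matrix n) → Upper A → Tri n
mkTri A up = toMat A , Equivalence.from (isUpper⇔Upper (toMat A))
                         λ i j j<i → trans (entry-toMat A i j) (up i j j<i)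

Tri-ext : {x y : Tri n} → (∀ i j → entries x i j ≡ entries y i j) → x ≡ y
Tri-ext x≗y = Σ-≡,≡→≡ (Mat-ext x≗y , T-irrelevant _ _)

-- Over 𝔽₂ subtraction is entrywise xor, so proj₁ (x ⊖ y) is definitionally
-- proj₁ x − proj₁ y.
_⊖_ : Tri n → Tri n → Tri n
x ⊖ y = mkTri (λ i j → entries x i j xor entries y i j)
              (λ i j j<i → cong₂ _xor_ (entries-upper x i j j<i) (entries-upper y i j j<i))

diag-⊖ : (x y : Tri n) (i : Fin n) → diag (x ⊖ y) i ≡ diag x i xor diag y i
diag-⊖ x y i = entry-toMat _ i i

-- Units of T n

⊙-diag : {A B : Matrix n} → Upper A → Upper B → (i : Fin n) → (A ⊙ B) i i ≡ A i i ∧ B i i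
⊙-diag {A = A} {B} upA upB i = sum-single (λ k → A i k ∧ B k i) i vanish
  where
    vanish : ∀ k → k ≢ i → A i k ∧ B k i ≡ false
    vanish k k≢i with <-cmp k i
    ... | tri< k<i _ _ = cong (_∧ B k i) (upA i k k<i)
    ... | tri≈ _ k≡i _ = ⊥-elim (k≢i k≡i)
    ... | tri> _ _ i<k = trans (cong (A i k ∧_) (upB k i i<k)) (∧-zeroʳ (A i k))

Unitriangular : Matrix n → Set
Unitriangular A = Upper A × (∀ i → A i i ≡ true)

minor : Matrix (suc n) → Matrix n
minor A i j = A (suc i) (suc j)

minor-unitriangular : {A : Matrix (suc n)} → Unitriangular A → Unitriangular (minor A)
minor-unitriangular (up , d) = (λ i j j<i → up (suc i) (suc j) (s≤s j<i)) , d ∘ suc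

-- Block inversion: over 𝔽₂, [[1 , r] , [0 , A′]]⁻¹ = [[1 , r A′⁻¹] , [0 , A′⁻¹]].
inverse : Matrix n → Matrix n
inverse {suc n} A zero    zero    = true
inverse {suc n} A zero    (suc j) = ((A zero ∘ suc) ⊛ inverse (minor A)) j
inverse {suc n} A (suc i) zero    = false
inverse {suc n} A (suc i) (suc j) = inverse (minor A) i j

inverse-upper : (A : Matrix n) → Upper (inverse A)
inverse-upper {suc n} A (suc i) zero    _         = refl
inverse-upper {suc n} A (suc i) (suc j) (s≤s j<i) = inverse-upper (minor A) i j j<i

⊙-inverse-column₀ : (X A : Matrix (suc n)) (i : Fin (suc n)) → (X ⊙ inverse A) i zero ≡ X i zero
⊙-inverse-column₀ X A i = begin
  X i zero ∧ true xor sum (λ k → X i (suc k) ∧ false)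
    ≡⟨ cong₂ _xor_ (∧-identityʳ (X i zero)) (sum-zero λ k → ∧-zeroʳ (X i (suc k))) ⟩
  X i zero xor false
    ≡⟨ xor-identityʳ (X i zero) ⟩
  X i zero
    ∎

⊙-upper-column₀ : (X : Matrix (suc n)) {A : Matrix (suc n)} → Upper A → (i : Fin (suc n)) →
                  (X ⊙ A) i zero ≡ X i zero ∧ A zero zero
⊙-upper-column₀ X {A} up i = begin
  X i zero ∧ A zero zero xor sum (λ k → X i (suc k) ∧ A (suc k) zero)
    ≡⟨ cong (X i zero ∧ A zero zero xor_) (sum-zero λ k →
         trans (cong (X i (suc k) ∧_) (up (suc k) zero z<s)) (∧-zeroʳ (X i (suc k)))) ⟩
  X i zero ∧ A zero zero xor false
    ≡⟨ xor-identityʳ (X i zero ∧ A zero zero) ⟩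
  X i zero ∧ A zero zero
    ∎

⊙-inverseʳ : {A : Matrix n} → Unitriangular A → ∀ i j → (A ⊙ inverse A) i j ≡ δ i j
⊙-inverseʳ {suc n} {A} (up , d) zero    zero    = trans (⊙-inverse-column₀ A A zero) (d zero)
⊙-inverseʳ {suc n} {A} (up , d) (suc i) zero    = trans (⊙-inverse-column₀ A A (suc i)) (up (suc i) zero z<s)
⊙-inverseʳ {suc n} {A} (up , d) zero    (suc j) = begin
  A zero zero ∧ r j xor r j  ≡⟨ cong (λ a → a ∧ r j xor r j) (d zero) ⟩
  r j xor r j                ≡⟨ xor-same (r j) ⟩
  false                      ∎
  where r = (A zero ∘ suc) ⊛ inverse (minor A)
⊙-inverseʳ {suc n} {A} (up , d) (suc i) (suc j) = begin
  A (suc i) zero ∧ r j xor (minor A ⊙ inverse (minor A)) i j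
    ≡⟨ cong (λ a → a ∧ r j xor (minor A ⊙ inverse (minor A)) i j) (up (suc i) zero z<s) ⟩
  (minor A ⊙ inverse (minor A)) i j
    ≡⟨ ⊙-inverseʳ (minor-unitriangular (up , d)) i j ⟩
  δ i j
    ∎
  where r = (A zero ∘ suc) ⊛ inverse (minor A)

⊙-inverseˡ : {A : Matrix n} → Unitriangular A → ∀ i j → (inverse A ⊙ A) i j ≡ δ i j
⊙-inverseˡ {suc n} {A} (up , d) zero    zero    = trans (⊙-upper-column₀ (inverse A) up zero) (d zero)
⊙-inverseˡ {suc n} {A} (up , d) (suc i) zero    = ⊙-upper-column₀ (inverse A) up (suc i)
⊙-inverseˡ {suc n} {A} (up , d) zero    (suc j) = begin
  r j xor ((r ⊛ B′) ⊛ minor A) j  ≡⟨ cong (r j xor_) (⊛-⊙-assoc r B′ (minor A) j) ⟩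
  r j xor (r ⊛ (B′ ⊙ minor A)) j  ≡⟨ cong (r j xor_) (⊛-cong r (⊙-inverseˡ (minor-unitriangular (up , d))) j) ⟩
  r j xor (r ⊛ δ) j               ≡⟨ cong (r j xor_) (⊛-δ r j) ⟩
  r j xor r j                     ≡⟨ xor-same (r j) ⟩
  false                           ∎
  where
    r  = A zero ∘ suc
    B′ = inverse (minor A)
⊙-inverseˡ {suc n} {A} (up , d) (suc i) (suc j) = ⊙-inverseˡ (minor-unitriangular (up , d)) i j

unit⇔diag≡true : (x : Tri n) → IsUnit (proj₁ x) ⇔ (∀ i → diag x i ≡ true)
unit⇔diag≡true {n} x = mk⇔ unit⇒ unit⇐
  where
    X = entries x

    unit⇒ : IsUnit (proj₁ x) → ∀ i → X i i ≡ true
    unit⇒ (y , xy≡I , _) i = ∧-conicalˡ (X i i) (entries y i i) (begin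
      X i i ∧ entries y i i          ≡⟨ ⊙-diag (entries-upper x) (entries-upper y) i ⟨
      (X ⊙ entries y) i i            ≡⟨ entry-· (proj₁ x) (proj₁ y) i i ⟨
      entry (proj₁ x · proj₁ y) i i  ≡⟨ cong (λ A → entry A i i) xy≡I ⟩
      entry I i i                    ≡⟨ entry-I i i ⟩
      δ i i                          ≡⟨ δ-refl i ⟩
      true                           ∎)

    unit⇐ : (∀ i → X i i ≡ true) → IsUnit (proj₁ x)
    unit⇐ d = y , Mat-ext xy≡I , Mat-ext yx≡I
      where
        y : Tri n
        y = mkTri (inverse X) (inverse-upper X)

        xy≡I : ∀ i j → entry (proj₁ x · proj₁ y) i j ≡ entry I i j
        xy≡I i j = begin
          entry (proj₁ x · proj₁ y) i j  ≡⟨ entry-· (proj₁ x) (proj₁ y) i j ⟩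
          (X ⊙ entries y) i j            ≡⟨ ⊛-cong (X i) (entry-toMat (inverse X)) j ⟩
          (X ⊙ inverse X) i j            ≡⟨ ⊙-inverseʳ (entries-upper x , d) i j ⟩
          δ i j                          ≡⟨ entry-I i j ⟨
          entry I i j                    ∎

        yx≡I : ∀ i j → entry (proj₁ y · proj₁ x) i j ≡ entry I i j
        yx≡I i j = begin
          entry (proj₁ y · proj₁ x) i j  ≡⟨ entry-· (proj₁ y) (proj₁ x) i j ⟩
          (entries y ⊙ X) i j            ≡⟨ sum-cong-≗ (λ k → cong (_∧ X k j) (entry-toMat (inverse X) i k)) ⟩
          (inverse X ⊙ X) i j            ≡⟨ ⊙-inverseˡ (entries-upper x , d) i j ⟩
          δ i j                          ≡⟨ entry-I i j ⟨
          entry I i j                    ∎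

-- Coordinates on T n: the diagonal and the strictly upper part

StrictUpper : ℕ → Set
StrictUpper zero    = ⊤
StrictUpper (suc n) = Vec 𝔽 n × StrictUpper n

strictPart : Matrix n → StrictUpper n
strictPart {zero}  A = tt
strictPart {suc n} A = tabulate (A zero ∘ suc) , strictPart (minor A)

strictPart-cong : {A B : Matrix n} → (∀ i j → A i j ≡ B i j) → strictPart A ≡ strictPart B
strictPart-cong {zero}  A≗B = refl
strictPart-cong {suc n} A≗B =
  cong₂ _,_ (tabulate-cong (A≗B zero ∘ suc)) (strictPart-cong λ i j → A≗B (suc i) (suc j))

triMatrix : (Fin n → 𝔽) → StrictUpper n → Matrix n
triMatrix d s       zero    zero    = d zero
triMatrix d (r , s) zero    (suc j) = lookup r j
triMatrix d s       (suc i) zero    = false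
triMatrix d (r , s) (suc i) (suc j) = triMatrix (d ∘ suc) s i j

triMatrix-upper : (d : Fin n → 𝔽) (s : StrictUpper n) → Upper (triMatrix d s)
triMatrix-upper d s       (suc i) zero    _         = refl
triMatrix-upper d (r , s) (suc i) (suc j) (s≤s j<i) = triMatrix-upper (d ∘ suc) s i j j<i

triMatrix-diag : (d : Fin n → 𝔽) (s : StrictUpper n) (i : Fin n) → triMatrix d s i i ≡ d i
triMatrix-diag d s       zero    = refl
triMatrix-diag d (r , s) (suc i) = triMatrix-diag (d ∘ suc) s i

strictPart-triMatrix : (d : Fin n → 𝔽) (s : StrictUpper n) → strictPart (triMatrix d s) ≡ s
strictPart-triMatrix {zero}  d s       = refl
strictPart-triMatrix {suc n} d (r , s) =
  cong₂ _,_ (tabulate∘lookup r) (strictPart-triMatrix (d ∘ suc) s)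

triMatrix-strictPart : {A : Matrix n} {d : Fin n → 𝔽} → Upper A → (∀ i → A i i ≡ d i) →
                       ∀ i j → triMatrix d (strictPart A) i j ≡ A i j
triMatrix-strictPart up diag≡d zero    zero    = sym (diag≡d zero)
triMatrix-strictPart up diag≡d zero    (suc j) = lookup∘tabulate _ j
triMatrix-strictPart up diag≡d (suc i) zero    = sym (up (suc i) zero z<s)
triMatrix-strictPart up diag≡d (suc i) (suc j) =
  triMatrix-strictPart (λ i j j<i → up (suc i) (suc j) (s≤s j<i)) (diag≡d ∘ suc) i j

build : (Fin n → 𝔽) → StrictUpper n → Tri n
build d s = mkTri (triMatrix d s) (triMatrix-upper d s)

diag-build : (d : Fin n → 𝔽) (s : StrictUpper n) → diag (build d s) ≗ d
diag-build d s i = trans (entry-toMat (triMatrix d s) i i) (triMatrix-diag d s i)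

strictPart-build : (d : Fin n → 𝔽) (s : StrictUpper n) → strictPart (entries (build d s)) ≡ s
strictPart-build d s = trans (strictPart-cong (entry-toMat (triMatrix d s))) (strictPart-triMatrix d s)

build-unique : (x : Tri n) {d : Fin n → 𝔽} → diag x ≗ d → build d (strictPart (entries x)) ≡ x
build-unique x diag≗d = Tri-ext λ i j →
  trans (entry-toMat _ i j) (triMatrix-strictPart (entries-upper x) diag≗d i j)

Fin[2^n]↔Vec : ∀ n → Fin (2 ^ n) ↔ Vec 𝔽 n
Fin[2^n]↔Vec zero    = mk↔ₛ′ (λ _ → []) (λ _ → zero) (λ { [] → refl }) (λ { zero → refl })
Fin[2^n]↔Vec (suc n) = ↔-trans *↔× (↔-trans (2↔Bool ×-↔ Fin[2^n]↔Vec n) ×↔Vec)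
  where
    ×↔Vec : (𝔽 × Vec 𝔽 n) ↔ Vec 𝔽 (suc n)
    ×↔Vec = mk↔ₛ′ (uncurry _∷_) (λ { (b ∷ v) → b , v }) (λ { (b ∷ v) → refl }) (λ _ → refl)

triangular : ℕ → ℕ
triangular zero    = 0
triangular (suc n) = n + triangular n

Fin[2^triangular]↔StrictUpper : ∀ n → Fin (2 ^ triangular n) ↔ StrictUpper n
Fin[2^triangular]↔StrictUpper zero    = 1↔⊤
Fin[2^triangular]↔StrictUpper (suc n) =
  subst (λ k → Fin k ↔ StrictUpper (suc n)) (sym (^-distribˡ-+-* 2 n (triangular n)))
        (↔-trans *↔× (Fin[2^n]↔Vec n ×-↔ Fin[2^triangular]↔StrictUpper n))

triangular-double : ∀ n → triangular (suc n) * 2 ≡ suc n * n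
triangular-double zero    = refl
triangular-double (suc n) = begin
  (suc n + triangular (suc n)) * 2    ≡⟨ *-distribʳ-+ 2 (suc n) (triangular (suc n)) ⟩
  suc n * 2 + triangular (suc n) * 2  ≡⟨ cong (suc n * 2 +_) (triangular-double n) ⟩
  suc n * 2 + suc n * n               ≡⟨ *-distribˡ-+ (suc n) 2 n ⟨
  suc n * suc (suc n)                 ≡⟨ *-comm (suc n) (suc (suc n)) ⟩
  suc (suc n) * suc n                 ∎

triangular≡ : ∀ n → triangular n ≡ (n * (n ∸ 1)) / 2
triangular≡ zero    = refl
triangular≡ (suc n) = begin
  triangular (suc n)          ≡⟨ m*n/n≡m (triangular (suc n)) 2 ⟨
  triangular (suc n) * 2 / 2  ≡⟨ cong (_/ 2) (triangular-double n) ⟩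
  suc n * n / 2               ∎

-- The unitary Cayley graph

xor-telescope : ∀ a b c → (a xor b) xor (b xor c) ≡ a xor c
xor-telescope false false c = refl
xor-telescope false true  c = not-involutive c
xor-telescope true  false c = refl
xor-telescope true  true  c = refl

≗-if-xor-constant : {f g : Fin n → 𝔽} {b : 𝔽} → (∀ i → f i xor g i ≡ b) →
                    ∀ i → f i ≡ g i → f ≗ g
≗-if-xor-constant {f = f} {g} {b} f+g≡b i fi≡gi j = ∙-cancelʳ (g j) (f j) (g j) (begin
  f j xor g j  ≡⟨ f+g≡b j ⟩
  b            ≡⟨ f+g≡b i ⟨
  f i xor g i  ≡⟨ cong (_xor g i) fi≡gi ⟩
  g i xor g i  ≡⟨ xor-same (g i) ⟩
  false        ≡⟨ xor-same (g j) ⟨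
  g j xor g j  ∎)

side : {A : Set} → A ⊎ A → 𝔽
side = [ const false , const true ]′

side-reduce-injective : {A : Set} {a b : A ⊎ A} → side a ≡ side b → reduce a ≡ reduce b → a ≡ b
side-reduce-injective {a = inj₁ x} {inj₁ y} _ refl = refl
side-reduce-injective {a = inj₂ x} {inj₂ y} _ refl = refl

KAdj⇔side-xor : {m : ℕ} (a b : Fin m ⊎ Fin m) → KAdj a b ⇔ (side a xor side b ≡ true)
KAdj⇔side-xor (inj₁ _) (inj₁ _) = mk⇔ (λ ()) (λ ())
KAdj⇔side-xor (inj₁ _) (inj₂ _) = mk⇔ (λ _ → refl) (λ _ → tt)
KAdj⇔side-xor (inj₂ _) (inj₁ _) = mk⇔ (λ _ → refl) (λ _ → tt)
KAdj⇔side-xor (inj₂ _) (inj₂ _) = mk⇔ (λ ()) (λ ())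

module _ {p : ℕ} where

  adjacent⇔complementary : (x y : Tri (suc p)) →
                           CayleyAdj x y ⇔ (∀ i → diag x i xor diag y i ≡ true)
  adjacent⇔complementary x y = mk⇔
    (λ (_ , unit) i → trans (sym (diag-⊖ x y i)) (Equivalence.to (unit⇔diag≡true (x ⊖ y)) unit i))
    (λ h → x≢y h , Equivalence.from (unit⇔diag≡true (x ⊖ y)) (λ i → trans (diag-⊖ x y i) (h i)))
    where
      x≢y : (∀ i → diag x i xor diag y i ≡ true) → x ≢ y
      x≢y h refl = contradiction (trans (sym (xor-same (diag x zero))) (h zero)) λ ()

  connected⇒diag-xor-constant : {x y : Tri (suc p)} → Connected CayleyAdj x y →
                                ∃[ b ] ∀ i → diag x i xor diag y i ≡ b
  connected⇒diag-xor-constant {x} ε = false , λ i → xor-same (diag x i)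
  connected⇒diag-xor-constant {x} {y} (_◅_ {j = z} x∼z z⇝y) with connected⇒diag-xor-constant z⇝y
  ... | b , h = not b , λ i → begin
    diag x i xor diag y i
      ≡⟨ xor-telescope (diag x i) (diag z i) (diag y i) ⟨
    (diag x i xor diag z i) xor (diag z i xor diag y i)
      ≡⟨ cong₂ _xor_ (Equivalence.to (adjacent⇔complementary x z) x∼z i) (h i) ⟩
    true xor b
      ∎

  diag-xor-constant⇒connected : {x y : Tri (suc p)} → (∃[ b ] ∀ i → diag x i xor diag y i ≡ b) →
                                Connected CayleyAdj x y
  diag-xor-constant⇒connected {x} {y} (true , h) = Equivalence.from (adjacent⇔complementary x y) h ◅ ε
  diag-xor-constant⇒connected {x} {y} (false , h) =
    Equivalence.from (adjacent⇔complementary x z) x∼z ◅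
    Equivalence.from (adjacent⇔complementary z y) z∼y ◅ ε
    where
      z : Tri (suc p)
      z = build (not ∘ diag x) (strictPart (entries x))

      diag-z : diag z ≗ not ∘ diag x
      diag-z = diag-build (not ∘ diag x) (strictPart (entries x))

      x∼z : ∀ i → diag x i xor diag z i ≡ true
      x∼z i = trans (cong (diag x i xor_) (diag-z i)) (xor-inverseʳ (diag x i))

      z∼y : ∀ i → diag z i xor diag y i ≡ true
      z∼y i = begin
        diag z i xor diag y i        ≡⟨ cong (_xor diag y i) (diag-z i) ⟩
        not (diag x i) xor diag y i  ≡⟨ not-distribˡ-xor (diag x i) (diag y i) ⟨
        not (diag x i xor diag y i)  ≡⟨ cong not (h i) ⟩
        true                         ∎

  -- One representative for each pair {d , not d} of diagonals: the diagonal
  -- matrix whose diagonal starts with false.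
  components : HasExactlyComponents (CayleyAdj {suc p}) (2 ^ p)
  components = rep , distinct , cover
    where
      open Inverse (Fin[2^n]↔Vec p)

      diagonal : Fin (2 ^ p) → Fin (suc p) → 𝔽
      diagonal a = lookup (false ∷ to a)

      rep : Fin (2 ^ p) → Tri (suc p)
      rep a = build (diagonal a) (strictPart λ _ _ → false)

      diag-rep : ∀ a → diag (rep a) ≗ diagonal a
      diag-rep a = diag-build (diagonal a) (strictPart λ _ _ → false)

      distinct : ∀ a b → Connected CayleyAdj (rep a) (rep b) → a ≡ b
      distinct a b c with connected⇒diag-xor-constant c
      ... | k , h = Injection.injective (↔⇒↣ (Fin[2^n]↔Vec p)) (Vec-ext (same ∘ suc))
        where
          h′ : ∀ i → diagonal a i xor diagonal b i ≡ k
          h′ i = trans (sym (cong₂ _xor_ (diag-rep a i) (diag-rep b i))) (h i)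

          same : diagonal a ≗ diagonal b
          same = ≗-if-xor-constant h′ zero refl

      cover : ∀ v → ∃ λ a → Connected CayleyAdj (rep a) v
      cover v = a , diag-xor-constant⇒connected (c , λ i → begin
        diag (rep a) i xor diag v i    ≡⟨ cong (_xor diag v i) (diag-rep-a i) ⟩
        (diag v i xor c) xor diag v i  ≡⟨ xyx⁻¹≈y (diag v i) c ⟩
        c                              ∎)
        where
          c : 𝔽
          c = diag v zero

          t : Vec 𝔽 p
          t = tabulate λ i → diag v (suc i) xor c

          a : Fin (2 ^ p)
          a = from t

          lookup-t : ∀ i → lookup (false ∷ t) i ≡ diag v i xor c
          lookup-t zero    = sym (xor-same c)
          lookup-t (suc i) = lookup∘tabulate _ i

          diag-rep-a : ∀ i → diag (rep a) i ≡ diag v i xor c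
          diag-rep-a i = begin
            diag (rep a) i           ≡⟨ diag-rep a i ⟩
            lookup (false ∷ to a) i  ≡⟨ cong (λ u → lookup (false ∷ u) i) (strictlyInverseˡ t) ⟩
            lookup (false ∷ t) i     ≡⟨ lookup-t i ⟩
            diag v i xor c           ∎

  component-iso : (v : Tri (suc p)) → ComponentIso (CayleyAdj {suc p}) v (KAdj {2 ^ ((suc p * p) / 2)})
  component-iso v = φ , φ-connected , φ-injective , φ-onto , φ-adjacent⇔
    where
      M : ℕ
      M = 2 ^ ((suc p * p) / 2)

      W : Set
      W = Fin M ⊎ Fin M

      code : Fin M ↔ StrictUpper (suc p)
      code = subst (λ k → Fin (2 ^ k) ↔ StrictUpper (suc p)) (triangular≡ (suc p))
                   (Fin[2^triangular]↔StrictUpper (suc p))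
      open Inverse code

      diagonal : W → Fin (suc p) → 𝔽
      diagonal w i = diag v i xor side w

      φ : W → Tri (suc p)
      φ w = build (diagonal w) (to (reduce w))

      diag-φ : ∀ w → diag (φ w) ≗ diagonal w
      diag-φ w = diag-build (diagonal w) (to (reduce w))

      φ-connected : ∀ w → Connected CayleyAdj v (φ w)
      φ-connected w = diag-xor-constant⇒connected (side w , λ i →
        trans (cong (diag v i xor_) (diag-φ w i)) (\\-leftDividesˡ (diag v i) (side w)))

      φ-injective : ∀ a b → φ a ≡ φ b → a ≡ b
      φ-injective a b φa≡φb = side-reduce-injective sides codes
        where
          sides : side a ≡ side b
          sides = ∙-cancelˡ (diag v zero) (side a) (side b) (begin
            diagonal a zero  ≡⟨ diag-φ a zero ⟨
            diag (φ a) zero  ≡⟨ cong (λ x → diag x zero) φa≡φb ⟩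
            diag (φ b) zero  ≡⟨ diag-φ b zero ⟩
            diagonal b zero  ∎)

          codes : reduce a ≡ reduce b
          codes = Injection.injective (↔⇒↣ code) (begin
            to (reduce a)               ≡⟨ strictPart-build (diagonal a) (to (reduce a)) ⟨
            strictPart (entries (φ a))  ≡⟨ cong (strictPart ∘ entries) φa≡φb ⟩
            strictPart (entries (φ b))  ≡⟨ strictPart-build (diagonal b) (to (reduce b)) ⟩
            to (reduce b)               ∎)

      codeOf : Tri (suc p) → Fin M
      codeOf u = from (strictPart (entries u))

      φ-preimage : ∀ w u → (∀ i → diag v i xor diag u i ≡ side w) → reduce w ≡ codeOf u → φ w ≡ u
      φ-preimage w u h r = begin
        build (diagonal w) (to (reduce w))
          ≡⟨ cong (build (diagonal w)) (trans (cong to r) (strictlyInverseˡ _)) ⟩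
        build (diagonal w) (strictPart (entries u))
          ≡⟨ build-unique u diag-u ⟩
        u
          ∎
        where
          diag-u : ∀ i → diag u i ≡ diagonal w i
          diag-u i = trans (sym (\\-leftDividesˡ (diag v i) (diag u i))) (cong (diag v i xor_) (h i))

      φ-onto : ∀ u → Connected CayleyAdj v u → ∃ λ w → φ w ≡ u
      φ-onto u c with connected⇒diag-xor-constant c
      ... | false , h = inj₁ (codeOf u) , φ-preimage (inj₁ (codeOf u)) u h refl
      ... | true  , h = inj₂ (codeOf u) , φ-preimage (inj₂ (codeOf u)) u h refl

      φ-adjacent⇔ : ∀ a b → CayleyAdj (φ a) (φ b) ⇔ KAdj a b
      φ-adjacent⇔ a b =
        ⇔.trans (adjacent⇔complementary (φ a) (φ b))
          (⇔.trans (mk⇔ (λ h → trans (sym (diag-xor zero)) (h zero)) (λ e i → trans (diag-xor i) e))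
                   (⇔.sym (KAdj⇔side-xor a b)))
        where
          diag-xor : ∀ i → diag (φ a) i xor diag (φ b) i ≡ side a xor side b
          diag-xor i = begin
            diag (φ a) i xor diag (φ b) i
              ≡⟨ cong₂ _xor_ (diag-φ a i) (diag-φ b i) ⟩
            (diag v i xor side a) xor (diag v i xor side b)
              ≡⟨ cong (_xor (diag v i xor side b)) (xor-comm (diag v i) (side a)) ⟩
            (side a xor diag v i) xor (diag v i xor side b)
              ≡⟨ xor-telescope (side a) (diag v i) (side b) ⟩
            side a xor side b
              ∎

theorem1 : (n : ℕ) → 2 ≤ n →
    HasExactlyComponents (CayleyAdj {n}) (2 ^ (n ∸ 1)) ×
    (∀ (v : Tri n) → ComponentIso (CayleyAdj {n}) v (KAdj {2 ^ ((n * (n ∸ 1)) / 2)}))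
theorem1 (suc p) _ = components , component-iso
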